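{- Let $S=\langle s_0,\dots,s_{n-1}\rangle$ be a non-empty sequence of binary strings whose set $S_{\mathrm{set}}$ of distinct strings is prefix-free, and let $\mathrm{WT}(S)$ be its Wavelet Trie, with $\mathrm{Rank}$ and $\mathrm{Select}$ available on the bitvectors stored at its internal nodes. Let $p$ be a binary string that is a prefix of at least one $s_i$. Then $\mathrm{RankPrefix}(p,\mathrm{pos})$ can be computed using $O(h_p)$ $\mathrm{Rank}$ operations on the bitvectors, and $\mathrm{SelectPrefix}(p,\mathrm{idx})$ can be computed using $O(h_p)$ $\mathrm{Select}$ operations on the bitvectors.
   Context: A set of binary strings is prefix-free if no element is a proper prefix of another. The Wavelet Trie $\mathrm{WT}(S)$ is defined recursively: (i) if all $s_i$ equal the same string $\alpha$, it is a single leaf labeled $\alpha$; (ii) otherwise let $\alpha$ be the longest common prefix of the $s_i$, write $s_i=\alpha b_i\gamma_i$ with $b_i\in\{0,1\}$, let $\beta=\langle b_0,\dots,b_{n-1}\rangle$ and $S_b=\langle \gamma_i : b_i=b\rangle$ for $b\in\{0,1\}$ (order preserved); $\mathrm{WT}(S)$ has an internal root labeled $\alpha$ and $\beta$ with $0$- and $1$-children $\mathrm{WT}(S_0)$, $\mathrm{WT}(S_1)$. For a prefix $p$ occurring in $S$, the strings of $S$ having prefix $p$ are exactly those represented in the subtree of a node $n_p$ obtained by prefix-searching $p$ in the trie; $h_p$ denotes the number of internal nodes on the path from the root to $n_p$. $\mathrm{RankPrefix}(p,\mathrm{pos})$ is the number of strings in $\langle s_0,\dots,s_{\mathrm{pos}-1}\rangle$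 having prefix $p$; $\mathrm{SelectPrefix}(p,\mathrm{idx})$ is the position of the $\mathrm{idx}$-th string in $S$ having prefix $p$. On a bitvector, $\mathrm{Rank}(b,\mathrm{pos})$ counts bits equal to $b$ among the first $\mathrm{pos}$ positions and $\mathrm{Select}(b,\mathrm{idx})$ returns the position of the $\mathrm{idx}$-th bit equal to $b$. -}

module Defs where

open import Data.Bool using (Bool; true; false; if_then_else_)
import Data.Bool as B
open import Data.Nat using (ℕ; zero; suc; _+_; _⊔_)
open import Data.List using (List; []; _∷_; length; filter; take; drop; map)
open import Data.List.Properties using (≡-dec)
open import Data.List.Membership.Propositional using (_∈_)
open import Data.List.Relation.Binary.Prefix.Heterogeneous using (Prefix)
open import Data.List.Relation.Binary.Prefix.Heterogeneous.Properties using (prefix?)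
open import Relation.Binary.PropositionalEquality using (_≡_)
open import Relation.Nullary using (does)

BitStr : Set
BitStr = List Bool

_⊑_ : BitStr → BitStr → Set
p ⊑ s = Prefix _≡_ p s

_⊑?_ : (p s : BitStr) → Relation.Nullary.Dec (p ⊑ s)
p ⊑? s = prefix? B._≟_ p s

PrefixFreeSet : List BitStr → Set
PrefixFreeSet S = ∀ {x y} → x ∈ S → y ∈ S → x ⊑ y → x ≡ y

rankBV : Bool → ℕ → List Bool → ℕ
rankBV b pos bv = length (filter (λ x → x B.≟ b) (take pos bv))

-- Select(b,idx): position of the idx-th (0-based) bit equal to b.
-- (Out of range: returns the length of the bitvector; never used under
-- the theorem's hypotheses.)
selectBV : Bool → ℕ → List Bool → ℕ
selectBV b idx [] = zero
selectBV b idx (x ∷ xs) with does (x B.≟ b) | idx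
... | true  | zero    = zero
... | true  | suc idx' = suc (selectBV b idx' xs)
... | false | _       = suc (selectBV b idx xs)

rankPrefix : List BitStr → BitStr → ℕ → ℕ
rankPrefix S p pos = length (filter (p ⊑?_) (take pos S))

countPrefix : List BitStr → BitStr → ℕ
countPrefix S p = length (filter (p ⊑?_) S)

selectPrefix : List BitStr → BitStr → ℕ → ℕ
selectPrefix [] p idx = zero
selectPrefix (s ∷ S) p idx with does (p ⊑? s) | idx
... | true  | zero     = zero
... | true  | suc idx' = suc (selectPrefix S p idx')
... | false | _        = suc (selectPrefix S p idx)

data WT : Set where
  leaf : BitStr → WT
  node : BitStr → List Bool → WT → WT → WT  -- internal: α, β, 0-child, 1-child

lcp2 : BitStr → BitStr → BitStr
lcp2 (x ∷ xs) (y ∷ ys) = if does (x B.≟ y) then x ∷ lcp2 xs ys else []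
lcp2 _ _ = []

lcp : List BitStr → BitStr
lcp [] = []
lcp (s ∷ []) = s
lcp (s ∷ S) = lcp2 s (lcp S)

allEqualTo : BitStr → List BitStr → Bool
allEqualTo a [] = true
allEqualTo a (s ∷ S) = does (≡-dec B._≟_ s a) B.∧ allEqualTo a S

headBit : BitStr → Bool
headBit [] = false
headBit (b ∷ _) = b

tailBits : BitStr → BitStr
tailBits [] = []
tailBits (_ ∷ xs) = xs

part : Bool → List BitStr → List BitStr
part b rs = map tailBits (filter (λ r → headBit r B.≟ b) rs)

maxLen : List BitStr → ℕ
maxLen [] = zero
maxLen (s ∷ S) = length s ⊔ maxLen S

wtF : ℕ → List BitStr → WT
wtF zero S = leaf []
wtF (suc f) [] = leaf []
wtF (suc f) (s ∷ S) =
  if allEqualTo s S then leaf s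
  else node α β (wtF f (part false rests)) (wtF f (part true rests))
  where
    α = lcp (s ∷ S)
    rests = map (drop (length α)) (s ∷ S)
    β = map headBit rests

-- WT(S); the fuel 1 + max length suffices since string lengths strictly
-- decrease at each level.
WTof : List BitStr → WT
WTof S = wtF (suc (maxLen S)) S

-- Number of internal nodes on the path from the root to the node n_p
-- reached by prefix-searching p (n_p itself counted if internal).
hp : WT → BitStr → ℕ
hp (leaf α) p = zero
hp (node α β t0 t1) p with p ⊑? α
... | Relation.Nullary.yes _ = 1
... | Relation.Nullary.no _ with drop (length α) p
...   | []          = 1
...   | false ∷ p'  = suc (hp t0 p')
...   | true  ∷ p'  = suc (hp t1 p')

-- Computation model: algorithms that see the trie's shape and labels,
-- and access the node bitvectors only through oracle queries.

data Skel : Set where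
  sleaf : BitStr → Skel
  snode : BitStr → Skel → Skel → Skel

skel : WT → Skel
skel (leaf α) = sleaf α
skel (node α β t0 t1) = snode α (skel t0) (skel t1)

-- Node address: sequence of child directions from the root.
Address : Set
Address = List Bool

data Prog (A : Set) : Set where
  ret : A → Prog A
  ask : Address → Bool → ℕ → (ℕ → Prog A) → Prog A

Oracle : Set
Oracle = Address → Bool → ℕ → ℕ

run : {A : Set} → Oracle → Prog A → A
run O (ret a) = a
run O (ask a b n k) = run O (k (O a b n))

cost : {A : Set} → Oracle → Prog A → ℕ
cost O (ret a) = zero
cost O (ask a b n k) = suc (cost O (k (O a b n)))

-- bitvector β stored at an address (empty if not an internal node)
bvAt : WT → Address → List Bool
bvAt (leaf _) _ = []
bvAt (node α β t0 t1) [] = β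
bvAt (node α β t0 t1) (false ∷ a) = bvAt t0 a
bvAt (node α β t0 t1) (true ∷ a) = bvAt t1 a

rankOracle : WT → Oracle
rankOracle t a b pos = rankBV b pos (bvAt t a)

selectOracle : WT → Oracle
selectOracle t a b idx = selectBV b idx (bvAt t a)

module Submission where

-- Prefix search for p walks down from the root of the Wavelet Trie. At an internal node
-- labelled α every string below extends α, and prefix-freeness guarantees that each of
-- them has a further bit after α (otherwise one string would be a prefix of all others).
-- Either p ⊑ α, and then every string below has prefix p, so RankPrefix and SelectPrefix
-- act as the identity on positions; or α ⊑ p = α b p', and a string below has prefix p
-- iff its bit after α is b and its remainder has prefix p'. Those remainders form, in
-- order, the sequence stored in the b-child, whose positions are the b-positions of β:
--   RankPrefix(p, pos)   = RankPrefix_b(p', Rank_β(b, pos)),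
--   SelectPrefix(p, idx) = Select_β(b, SelectPrefix_b(p', idx)).
-- Hence one Rank (resp. Select) per internal node on the search path suffices.

open import Defs
open import Data.Bool using (Bool; true; false; if_then_else_)
import Data.Bool as B
open import Data.Nat using (ℕ; zero; suc; _+_; _*_; _≤_; _<_; z≤n; s≤s; s≤s⁻¹)
open import Data.Nat.Properties
  using (≤-trans; ≤-reflexive; +-comm; *-identityˡ; m∸n≤m; m≤m⊔n; m≤n⊔m; module ≤-Reasoning)
open import Data.List using (List; []; _∷_; length; drop; map)
open import Data.List.Properties using (∷-injectiveʳ; length-drop; ≡-dec)
open import Data.List.Relation.Unary.Any using (Any; here; there)
open import Data.List.Relation.Unary.Any.Properties using (¬Any[])
open import Data.List.Relation.Unary.All using (All; []; _∷_)
import Data.List.Relation.Unary.All as All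
import Data.List.Relation.Unary.All.Properties as All
open import Data.List.Membership.Propositional using (_∈_; find; lose)
open import Data.List.Membership.Propositional.Properties
  using (∈-map⁺; ∈-map⁻; ∈-filter⁺; ∈-filter⁻)
import Data.List.Relation.Binary.Pointwise as Pointwise
open import Data.List.Relation.Binary.Prefix.Heterogeneous using ([]; _∷_)
import Data.List.Relation.Binary.Prefix.Heterogeneous.Properties as Prefix
open import Data.Product using (Σ; _×_; _,_; proj₂)
open import Data.Sum using (_⊎_; inj₁; inj₂)
open import Data.Empty using (⊥-elim)
open import Function using (_∘_)
open import Function.Bundles using (_⇔_; mk⇔; Equivalence)
open import Relation.Nullary using (¬_; yes; no; does; contradiction)
open import Relation.Nullary.Decidable using (does-⇔; dec-true)
open import Relation.Binary.PropositionalEquality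

⊑-refl : ∀ {x} → x ⊑ x
⊑-refl = Prefix.fromPointwise (Pointwise.refl refl)

⊑-trans : ∀ {x y z} → x ⊑ y → y ⊑ z → x ⊑ z
⊑-trans = Prefix.trans trans

⊑-comparable : ∀ {p q x} → p ⊑ x → q ⊑ x → p ⊑ q ⊎ q ⊑ p
⊑-comparable []           _            = inj₁ []
⊑-comparable (_ ∷ _)      []           = inj₂ []
⊑-comparable (refl ∷ p⊑x) (refl ∷ q⊑x) with ⊑-comparable p⊑x q⊑x
... | inj₁ p⊑q = inj₁ (refl ∷ p⊑q)
... | inj₂ q⊑p = inj₂ (refl ∷ q⊑p)

drop-length⁻ : ∀ {α p x} → α ⊑ p → α ⊑ x →
               drop (length α) p ⊑ drop (length α) x → p ⊑ x
drop-length⁻ []           []           p⊑x = p⊑x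
drop-length⁻ (refl ∷ α⊑p) (refl ∷ α⊑x) p⊑x = refl ∷ drop-length⁻ α⊑p α⊑x p⊑x

⊑⇔drop-length-⊑ : ∀ {α p x} → α ⊑ p → α ⊑ x →
                   p ⊑ x ⇔ drop (length α) p ⊑ drop (length α) x
⊑⇔drop-length-⊑ {α} α⊑p α⊑x = mk⇔ (Prefix.drop⁺ (length α)) (drop-length⁻ α⊑p α⊑x)

drop-length≡[]⇒≡ : ∀ {α x} → α ⊑ x → drop (length α) x ≡ [] → x ≡ α
drop-length≡[]⇒≡ []           x≡[]    = x≡[]
drop-length≡[]⇒≡ (refl ∷ α⊑x) rest≡[] = cong (_ ∷_) (drop-length≡[]⇒≡ α⊑x rest≡[])

length-drop≤ : ∀ k (x : BitStr) → length (drop k x) ≤ length x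
length-drop≤ k x = ≤-trans (≤-reflexive (length-drop k x)) (m∸n≤m (length x) k)

lcp2-⊑ˡ : ∀ x y → lcp2 x y ⊑ x
lcp2-⊑ˡ []      _       = []
lcp2-⊑ˡ (_ ∷ _) []      = []
lcp2-⊑ˡ (b ∷ x) (c ∷ y) with b B.≟ c
... | yes _ = refl ∷ lcp2-⊑ˡ x y
... | no  _ = []

lcp2-⊑ʳ : ∀ x y → lcp2 x y ⊑ y
lcp2-⊑ʳ []      _       = []
lcp2-⊑ʳ (_ ∷ _) []      = []
lcp2-⊑ʳ (b ∷ x) (c ∷ y) with b B.≟ c
... | yes refl = refl ∷ lcp2-⊑ʳ x y
... | no  _    = []

lcp-⊑ : ∀ s S → All (lcp (s ∷ S) ⊑_) (s ∷ S)
lcp-⊑ s []      = ⊑-refl ∷ []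
lcp-⊑ s (t ∷ S) =
  lcp2-⊑ˡ s (lcp (t ∷ S)) ∷ All.map (⊑-trans (lcp2-⊑ʳ s (lcp (t ∷ S)))) (lcp-⊑ t S)

allEqualTo-sound : ∀ {a} S → allEqualTo a S ≡ true → All (_≡ a) S
allEqualTo-sound     []      _  = []
allEqualTo-sound {a} (s ∷ S) eq with ≡-dec B._≟_ s a
... | yes s≡a = s≡a ∷ allEqualTo-sound S eq

allEqualTo-complete : ∀ {a S} → All (_≡ a) S → allEqualTo a S ≡ true
allEqualTo-complete             []          = refl
allEqualTo-complete {a} {s ∷ _} (s≡a ∷ eqs)
  rewrite dec-true (≡-dec B._≟_ s a) s≡a = allEqualTo-complete eqs

All-≡∧Any⇒All : ∀ {A : Set} {P : A → Set} {a xs} → All (_≡ a) xs → Any P xs → All P xs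
All-≡∧Any⇒All {P = P} eqs hit with find hit
... | x , x∈ , Px = All.map (λ y≡a → subst P (trans (All.lookup eqs x∈) (sym y≡a)) Px) eqs

⊑-least⇒All-≡ : ∀ {S x} → PrefixFreeSet S → x ∈ S → All (x ⊑_) S → All (_≡ x) S
⊑-least⇒All-≡ prefixFree x∈ x⊑ = All.tabulate λ y∈ → sym (prefixFree x∈ y∈ (All.lookup x⊑ y∈))

drop-lcp≡[]⇒allEqual : ∀ {s S x} → PrefixFreeSet (s ∷ S) → x ∈ s ∷ S →
                       drop (length (lcp (s ∷ S))) x ≡ [] → allEqualTo s S ≡ true
drop-lcp≡[]⇒allEqual {s} {S} {x} prefixFree x∈ rest≡[] =
  allEqualTo-complete (All.map (λ y≡x → trans y≡x (sym (All.head all≡x))) (All.tail all≡x))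
  where
  x≡lcp : x ≡ lcp (s ∷ S)
  x≡lcp = drop-length≡[]⇒≡ (All.lookup (lcp-⊑ s S) x∈) rest≡[]
  all≡x : All (_≡ x) (s ∷ S)
  all≡x = ⊑-least⇒All-≡ prefixFree x∈ (All.map (subst (_⊑ _) (sym x≡lcp)) (lcp-⊑ s S))

≢[]⇒≡headBit∷tailBits : ∀ {r : BitStr} → r ≢ [] → r ≡ headBit r ∷ tailBits r
≢[]⇒≡headBit∷tailBits {[]}    r≢[] = ⊥-elim (r≢[] refl)
≢[]⇒≡headBit∷tailBits {_ ∷ _} _    = refl

∈-part⁺ : ∀ {b y R} → b ∷ y ∈ R → y ∈ part b R
∈-part⁺ {b} by∈R = ∈-map⁺ tailBits (∈-filter⁺ (λ r → headBit r B.≟ b) by∈R refl)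

∈-part⁻ : ∀ {b y R} → All (_≢ []) R → y ∈ part b R → b ∷ y ∈ R
∈-part⁻ {b} nonempty y∈ with ∈-map⁻ tailBits y∈
... | r , r∈ , refl with ∈-filter⁻ (λ r → headBit r B.≟ b) r∈
...   | r∈R , refl = subst (_∈ _) (≢[]⇒≡headBit∷tailBits (All.lookup nonempty r∈R)) r∈R

part-Any : ∀ {b p R} → Any ((b ∷ p) ⊑_) R → Any (p ⊑_) (part b R)
part-Any hit with find hit
... | _ ∷ _ , r∈ , refl ∷ p⊑ = lose (∈-part⁺ r∈) p⊑

part-prefixFree : ∀ {b R} → All (_≢ []) R → PrefixFreeSet R → PrefixFreeSet (part b R)
part-prefixFree nonempty prefixFree y∈ z∈ y⊑z =
  ∷-injectiveʳ (prefixFree (∈-part⁻ nonempty y∈) (∈-part⁻ nonempty z∈) (refl ∷ y⊑z))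

part-length< : ∀ {b g R} → All (_≢ []) R → All (λ r → length r < suc g) R →
               All (λ y → length y < g) (part b R)
part-length< nonempty short = All.tabulate λ y∈ → s≤s⁻¹ (All.lookup short (∈-part⁻ nonempty y∈))

Any-map-⇔ : ∀ {A B : Set} {P : A → Set} {Q : B → Set} {f : A → B} {xs} →
            (∀ {x} → x ∈ xs → P x ⇔ Q (f x)) → Any P xs → Any Q (map f xs)
Any-map-⇔ {f = f} P⇔Q hit with find hit
... | x , x∈ , Px = lose (∈-map⁺ f x∈) (Equivalence.to (P⇔Q x∈) Px)

drop-prefixFree : ∀ {α L} → All (α ⊑_) L → PrefixFreeSet L →
                  PrefixFreeSet (map (drop (length α)) L)
drop-prefixFree {α} α⊑ prefixFree y∈ z∈ y⊑z
  with ∈-map⁻ (drop (length α)) y∈ | ∈-map⁻ (drop (length α)) z∈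
... | x , x∈ , refl | x' , x'∈ , refl =
  cong (drop (length α)) (prefixFree x∈ x'∈ (drop-length⁻ (All.lookup α⊑ x∈) (All.lookup α⊑ x'∈) y⊑z))

drop-length< : ∀ {k g L} → All (λ x → length x < g) L → All (λ y → length y < g) (map (drop k) L)
drop-length< {k} short = All.map⁺ (All.map (λ {x} → ≤-trans (s≤s (length-drop≤ k x))) short)

module _ {p q : BitStr} {f : BitStr → BitStr} where

  rankPrefix-map : ∀ {L} → (∀ {x} → x ∈ L → p ⊑ x ⇔ q ⊑ f x) →
                   ∀ pos → rankPrefix L p pos ≡ rankPrefix (map f L) q pos
  rankPrefix-map {[]}    p⇔q zero    = refl
  rankPrefix-map {[]}    p⇔q (suc _) = refl
  rankPrefix-map {x ∷ L} p⇔q zero    = refl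
  rankPrefix-map {x ∷ L} p⇔q (suc pos)
    rewrite does-⇔ (p⇔q (here refl)) (p ⊑? x) (q ⊑? f x)
    with does (q ⊑? f x)
  ... | true  = cong suc (rankPrefix-map (p⇔q ∘ there) pos)
  ... | false = rankPrefix-map (p⇔q ∘ there) pos

  countPrefix-map : ∀ {L} → (∀ {x} → x ∈ L → p ⊑ x ⇔ q ⊑ f x) →
                    countPrefix L p ≡ countPrefix (map f L) q
  countPrefix-map {[]}    p⇔q = refl
  countPrefix-map {x ∷ L} p⇔q
    rewrite does-⇔ (p⇔q (here refl)) (p ⊑? x) (q ⊑? f x)
    with does (q ⊑? f x)
  ... | true  = cong suc (countPrefix-map (p⇔q ∘ there))
  ... | false = countPrefix-map (p⇔q ∘ there)

  selectPrefix-map : ∀ {L} → (∀ {x} → x ∈ L → p ⊑ x ⇔ q ⊑ f x) →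
                     ∀ idx → selectPrefix L p idx ≡ selectPrefix (map f L) q idx
  selectPrefix-map {[]}    p⇔q idx = refl
  selectPrefix-map {x ∷ L} p⇔q idx
    rewrite does-⇔ (p⇔q (here refl)) (p ⊑? x) (q ⊑? f x)
    with does (q ⊑? f x) | idx
  ... | true  | zero  = refl
  ... | true  | suc i = cong suc (selectPrefix-map (p⇔q ∘ there) i)
  ... | false | i     = cong suc (selectPrefix-map (p⇔q ∘ there) i)

rankPrefix-part : ∀ b p {R} → All (_≢ []) R → ∀ pos →
                  rankPrefix R (b ∷ p) pos ≡ rankPrefix (part b R) p (rankBV b pos (map headBit R))
rankPrefix-part b p ne zero = refl
rankPrefix-part b p {[]}     ne       (suc pos) = refl
rankPrefix-part b p {[] ∷ R} (ne ∷ _) (suc pos) = ⊥-elim (ne refl)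
rankPrefix-part false p {(false ∷ γ) ∷ R} (_ ∷ ne) (suc pos) with does (p ⊑? γ)
... | true  = cong suc (rankPrefix-part false p ne pos)
... | false = rankPrefix-part false p ne pos
rankPrefix-part true p {(true ∷ γ) ∷ R} (_ ∷ ne) (suc pos) with does (p ⊑? γ)
... | true  = cong suc (rankPrefix-part true p ne pos)
... | false = rankPrefix-part true p ne pos
rankPrefix-part false p {(true ∷ γ) ∷ R} (_ ∷ ne) (suc pos) = rankPrefix-part false p ne pos
rankPrefix-part true p {(false ∷ γ) ∷ R} (_ ∷ ne) (suc pos) = rankPrefix-part true p ne pos

countPrefix-part : ∀ b p {R} → All (_≢ []) R → countPrefix R (b ∷ p) ≡ countPrefix (part b R) p
countPrefix-part b p {[]}     ne       = refl
countPrefix-part b p {[] ∷ R} (ne ∷ _) = ⊥-elim (ne refl)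
countPrefix-part false p {(false ∷ γ) ∷ R} (_ ∷ ne) with does (p ⊑? γ)
... | true  = cong suc (countPrefix-part false p ne)
... | false = countPrefix-part false p ne
countPrefix-part true p {(true ∷ γ) ∷ R} (_ ∷ ne) with does (p ⊑? γ)
... | true  = cong suc (countPrefix-part true p ne)
... | false = countPrefix-part true p ne
countPrefix-part false p {(true ∷ γ) ∷ R} (_ ∷ ne) = countPrefix-part false p ne
countPrefix-part true p {(false ∷ γ) ∷ R} (_ ∷ ne) = countPrefix-part true p ne

selectPrefix-part : ∀ b p {R} → All (_≢ []) R → ∀ idx →
                    selectPrefix R (b ∷ p) idx ≡ selectBV b (selectPrefix (part b R) p idx) (map headBit R)
selectPrefix-part b p {[]}     ne       idx = refl
selectPrefix-part b p {[] ∷ R} (ne ∷ _) idx = ⊥-elim (ne refl)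
selectPrefix-part false p {(false ∷ γ) ∷ R} (_ ∷ ne) idx with does (p ⊑? γ) | idx
... | true  | zero  = refl
... | true  | suc i = cong suc (selectPrefix-part false p ne i)
... | false | i     = cong suc (selectPrefix-part false p ne i)
selectPrefix-part true p {(true ∷ γ) ∷ R} (_ ∷ ne) idx with does (p ⊑? γ) | idx
... | true  | zero  = refl
... | true  | suc i = cong suc (selectPrefix-part true p ne i)
... | false | i     = cong suc (selectPrefix-part true p ne i)
selectPrefix-part false p {(true ∷ γ) ∷ R} (_ ∷ ne) idx = cong suc (selectPrefix-part false p ne idx)
selectPrefix-part true p {(false ∷ γ) ∷ R} (_ ∷ ne) idx = cong suc (selectPrefix-part true p ne idx)

rankPrefix-all : ∀ {p L pos} → All (p ⊑_) L → pos ≤ length L → rankPrefix L p pos ≡ pos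
rankPrefix-all {pos = zero} _ _ = refl
rankPrefix-all {p} {x ∷ L} {suc pos} (px ∷ all) (s≤s pos≤) rewrite dec-true (p ⊑? x) px =
  cong suc (rankPrefix-all all pos≤)

selectPrefix-all : ∀ {p L idx} → All (p ⊑_) L → idx < countPrefix L p → selectPrefix L p idx ≡ idx
selectPrefix-all {p} {x ∷ L} {zero}    (px ∷ _)   _    rewrite dec-true (p ⊑? x) px = refl
selectPrefix-all {p} {x ∷ L} {suc idx} (px ∷ all) idx< rewrite dec-true (p ⊑? x) px =
  cong suc (selectPrefix-all all (s≤s⁻¹ idx<))

rankBV≤length-part : ∀ b pos R → rankBV b pos (map headBit R) ≤ length (part b R)
rankBV≤length-part b zero      R       = z≤n
rankBV≤length-part b (suc pos) []      = z≤n
rankBV≤length-part b (suc pos) (r ∷ R) with does (headBit r B.≟ b)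
... | true  = s≤s (rankBV≤length-part b pos R)
... | false = rankBV≤length-part b pos R

_>>=_ : {A B : Set} → Prog A → (A → Prog B) → Prog B
ret a       >>= k = k a
ask a b n g >>= k = ask a b n (λ r → g r >>= k)

-- A program for the subtrie of the b-child, whose addresses are relative to that child.
atChild : {A : Set} → Bool → Prog A → Prog A
atChild b (ret a)       = ret a
atChild b (ask a c n k) = ask (b ∷ a) c n (λ r → atChild b (k r))

run-bind : ∀ {A B : Set} O (m : Prog A) (k : A → Prog B) → run O (m >>= k) ≡ run O (k (run O m))
run-bind O (ret a)       k = refl
run-bind O (ask a b n g) k = run-bind O (g (O a b n)) k

cost-bind : ∀ {A B : Set} O (m : Prog A) (k : A → Prog B) →
            cost O (m >>= k) ≡ cost O m + cost O (k (run O m))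
cost-bind O (ret a)       k = refl
cost-bind O (ask a b n g) k = cong suc (cost-bind O (g (O a b n)) k)

run-atChild : ∀ {A : Set} O b (m : Prog A) → run O (atChild b m) ≡ run (λ a → O (b ∷ a)) m
run-atChild O b (ret a)       = refl
run-atChild O b (ask a c n k) = run-atChild O b (k (O (b ∷ a) c n))

cost-atChild : ∀ {A : Set} O b (m : Prog A) → cost O (atChild b m) ≡ cost (λ a → O (b ∷ a)) m
cost-atChild O b (ret a)       = refl
cost-atChild O b (ask a c n k) = cong suc (cost-atChild O b (k (O (b ∷ a) c n)))

bvOracle : (Bool → ℕ → List Bool → ℕ) → WT → Oracle
bvOracle q t a b n = q b n (bvAt t a)

run-atChild-node : ∀ {A : Set} q α β (t : Bool → WT) (m : Bool → Prog A) b →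
                   run (bvOracle q (node α β (t false) (t true))) (atChild b (if b then m true else m false))
                   ≡ run (bvOracle q (t b)) (m b)
run-atChild-node q α β t m false = run-atChild _ false (m false)
run-atChild-node q α β t m true  = run-atChild _ true  (m true)

data Step : Set where
  stop : Step
  down : Bool → BitStr → Step

-- The same case analysis as in hp, so that costs can be compared with hp node by node.
step : BitStr → BitStr → Step
step α p with p ⊑? α
... | yes _ = stop
... | no  _ with drop (length α) p
...   | []     = stop
...   | b ∷ p' = down b p'

rankAlg : Skel → BitStr → ℕ → Prog ℕ
rankAlg (sleaf _)       p pos = ret pos
rankAlg (snode α s₀ s₁) p pos with step α p
... | stop      = ret pos
... | down b p' = ask [] b pos (λ r → atChild b (if b then rankAlg s₁ p' r else rankAlg s₀ p' r))

selectAlg : Skel → BitStr → ℕ → Prog ℕ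
selectAlg (sleaf _)       p idx = ret idx
selectAlg (snode α s₀ s₁) p idx with step α p
... | stop      = ret idx
... | down b p' =
  atChild b (if b then selectAlg s₁ p' idx else selectAlg s₀ p' idx) >>= λ r → ask [] b r ret

rankAlg-cost : ∀ O t p pos → cost O (rankAlg (skel t) p pos) ≤ hp t p
rankAlg-cost O (leaf _) p pos = z≤n
rankAlg-cost O (node α β t₀ t₁) p pos with p ⊑? α
... | yes _ = z≤n
... | no  _ with drop (length α) p
...   | []         = z≤n
...   | false ∷ p' = s≤s (≤-trans (≤-reflexive (cost-atChild O false _)) (rankAlg-cost _ t₀ p' _))
...   | true  ∷ p' = s≤s (≤-trans (≤-reflexive (cost-atChild O true  _)) (rankAlg-cost _ t₁ p' _))

cost-atChild-ask : ∀ O b (m : Prog ℕ) {h} → cost (λ a → O (b ∷ a)) m ≤ h →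
                   cost O (atChild b m >>= λ r → ask [] b r ret) ≤ suc h
cost-atChild-ask O b m {h} cost≤ = begin
  cost O (atChild b m >>= λ r → ask [] b r ret) ≡⟨ cost-bind O (atChild b m) _ ⟩
  cost O (atChild b m) + 1                      ≡⟨ cong (_+ 1) (cost-atChild O b m) ⟩
  cost (λ a → O (b ∷ a)) m + 1                  ≡⟨ +-comm _ 1 ⟩
  suc (cost (λ a → O (b ∷ a)) m)                ≤⟨ s≤s cost≤ ⟩
  suc h                                         ∎
  where open ≤-Reasoning

selectAlg-cost : ∀ O t p idx → cost O (selectAlg (skel t) p idx) ≤ hp t p
selectAlg-cost O (leaf _) p idx = z≤n
selectAlg-cost O (node α β t₀ t₁) p idx with p ⊑? α
... | yes _ = z≤n
... | no  _ with drop (length α) p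
...   | []         = z≤n
...   | false ∷ p' = cost-atChild-ask O false _ (selectAlg-cost _ t₀ p' idx)
...   | true  ∷ p' = cost-atChild-ask O true  _ (selectAlg-cost _ t₁ p' idx)

step≡down⇒ : ∀ {α p b p'} → step α p ≡ down b p' → ¬ p ⊑ α × drop (length α) p ≡ b ∷ p'
step≡down⇒ {α} {p} eq with p ⊑? α
... | yes _ with () ← eq
... | no p⋢α with drop (length α) p
...   | []    with () ← eq
...   | _ ∷ _ with refl ← eq = p⋢α , refl

step≡stop⇒ : ∀ {α p} → step α p ≡ stop → p ⊑ α ⊎ α ⊑ p → p ⊑ α
step≡stop⇒ {α} {p} eq comparable with p ⊑? α
... | yes p⊑α = p⊑α
... | no p⋢α with drop (length α) p in rest≡ | comparable
...   | []    | inj₁ p⊑α = p⊑α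
...   | []    | inj₂ α⊑p = subst (_⊑ α) (sym (drop-length≡[]⇒≡ α⊑p rest≡)) ⊑-refl
...   | _ ∷ _ | _ with () ← eq

-- The bound on lengths keeps wtF g S from running out of fuel before reaching its leaves.
record Searchable (g : ℕ) (S : List BitStr) (p : BitStr) : Set where
  field
    hit        : Any (p ⊑_) S
    prefixFree : PrefixFreeSet S
    fuel       : All (λ s → length s < g) S

  ⊑-comparable-with : ∀ {α} → All (α ⊑_) S → p ⊑ α ⊎ α ⊑ p
  ⊑-comparable-with α⊑ with find hit
  ... | x , x∈ , p⊑x = ⊑-comparable p⊑x (All.lookup α⊑ x∈)

allEqual⇒All-⊑ : ∀ {g s S p} → Searchable g (s ∷ S) p → allEqualTo s S ≡ true → All (p ⊑_) (s ∷ S)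
allEqual⇒All-⊑ {S = S} searchable uniform =
  All-≡∧Any⇒All (refl ∷ allEqualTo-sound S uniform) (Searchable.hit searchable)

step≡stop⇒All-⊑ : ∀ {g s S p} → Searchable g (s ∷ S) p → step (lcp (s ∷ S)) p ≡ stop →
                  All (p ⊑_) (s ∷ S)
step≡stop⇒All-⊑ {s = s} {S} {p} searchable stops = All.map (⊑-trans p⊑lcp) (lcp-⊑ s S)
  where
  p⊑lcp : p ⊑ lcp (s ∷ S)
  p⊑lcp = step≡stop⇒ {lcp (s ∷ S)} {p} stops (Searchable.⊑-comparable-with searchable (lcp-⊑ s S))

module Descent {g s S p b p'} (searchable : Searchable (suc g) (s ∷ S) p)
               (split : allEqualTo s S ≡ false) (moves : step (lcp (s ∷ S)) p ≡ down b p') where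
  open Searchable searchable

  α : BitStr
  α = lcp (s ∷ S)

  rests : List BitStr
  rests = map (drop (length α)) (s ∷ S)

  descends : ¬ p ⊑ α × drop (length α) p ≡ b ∷ p'
  descends = step≡down⇒ {α} {p} moves

  α⊑p : α ⊑ p
  α⊑p with ⊑-comparable-with (lcp-⊑ s S) | descends
  ... | inj₁ p⊑α | p⋢α , _ = ⊥-elim (p⋢α p⊑α)
  ... | inj₂ α⊑p | _       = α⊑p

  ⊑⇔⊑-rest : ∀ {x} → x ∈ s ∷ S → p ⊑ x ⇔ (b ∷ p') ⊑ drop (length α) x
  ⊑⇔⊑-rest {x} x∈ = subst (λ q → p ⊑ x ⇔ q ⊑ drop (length α) x) (proj₂ descends)
                          (⊑⇔drop-length-⊑ α⊑p (All.lookup (lcp-⊑ s S) x∈))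

  rests-nonempty : All (_≢ []) rests
  rests-nonempty = All.map⁺ {f = drop (length α)} (All.tabulate λ x∈ rest≡[] →
    contradiction (trans (sym (drop-lcp≡[]⇒allEqual prefixFree x∈ rest≡[])) split) λ ())

  child-searchable : Searchable g (part b rests) p'
  child-searchable = record
    { hit        = part-Any (Any-map-⇔ ⊑⇔⊑-rest hit)
    ; prefixFree = part-prefixFree rests-nonempty (drop-prefixFree (lcp-⊑ s S) prefixFree)
    ; fuel       = part-length< rests-nonempty (drop-length< {length α} fuel)
    }

  rankPrefix-descent : ∀ pos → rankPrefix (s ∷ S) p pos
                               ≡ rankPrefix (part b rests) p' (rankBV b pos (map headBit rests))
  rankPrefix-descent pos =
    trans (rankPrefix-map ⊑⇔⊑-rest pos) (rankPrefix-part b p' rests-nonempty pos)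

  countPrefix-descent : countPrefix (s ∷ S) p ≡ countPrefix (part b rests) p'
  countPrefix-descent = trans (countPrefix-map ⊑⇔⊑-rest) (countPrefix-part b p' rests-nonempty)

  selectPrefix-descent : ∀ idx → selectPrefix (s ∷ S) p idx
                                 ≡ selectBV b (selectPrefix (part b rests) p' idx) (map headBit rests)
  selectPrefix-descent idx =
    trans (selectPrefix-map ⊑⇔⊑-rest idx) (selectPrefix-part b p' rests-nonempty idx)

rankAlg-correct : ∀ g S p pos → Searchable g S p → pos ≤ length S →
                  run (rankOracle (wtF g S)) (rankAlg (skel (wtF g S)) p pos) ≡ rankPrefix S p pos
rankAlg-correct g       []      p pos searchable _ = ⊥-elim (¬Any[] (Searchable.hit searchable))
rankAlg-correct zero    (s ∷ S) p pos searchable _ with Searchable.fuel searchable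
... | () ∷ _
rankAlg-correct (suc g) (s ∷ S) p pos searchable pos≤ with allEqualTo s S in uniform
... | true = sym (rankPrefix-all (allEqual⇒All-⊑ searchable uniform) pos≤)
... | false with step (lcp (s ∷ S)) p in moves
...   | stop      = sym (rankPrefix-all (step≡stop⇒All-⊑ searchable moves) pos≤)
...   | down b p' = begin
    run (bvOracle rankBV (node α (map headBit rests) (t false) (t true)))
        (atChild b (if b then m true else m false))
      ≡⟨ run-atChild-node rankBV α _ t m b ⟩
    run (rankOracle (t b)) (m b)
      ≡⟨ rankAlg-correct g _ p' pos' child-searchable (rankBV≤length-part b pos rests) ⟩
    rankPrefix (part b rests) p' pos'
      ≡⟨ rankPrefix-descent pos ⟨
    rankPrefix (s ∷ S) p pos
      ∎
  where
  open Descent searchable uniform moves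
  open ≡-Reasoning
  t : Bool → WT
  t c = wtF g (part c rests)
  pos' : ℕ
  pos' = rankBV b pos (map headBit rests)
  m : Bool → Prog ℕ
  m c = rankAlg (skel (t c)) p' pos'

selectAlg-correct : ∀ g S p idx → Searchable g S p → idx < countPrefix S p →
                    run (selectOracle (wtF g S)) (selectAlg (skel (wtF g S)) p idx) ≡ selectPrefix S p idx
selectAlg-correct g       []      p idx searchable _ = ⊥-elim (¬Any[] (Searchable.hit searchable))
selectAlg-correct zero    (s ∷ S) p idx searchable _ with Searchable.fuel searchable
... | () ∷ _
selectAlg-correct (suc g) (s ∷ S) p idx searchable idx< with allEqualTo s S in uniform
... | true = sym (selectPrefix-all (allEqual⇒All-⊑ searchable uniform) idx<)
... | false with step (lcp (s ∷ S)) p in moves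
...   | stop      = sym (selectPrefix-all (step≡stop⇒All-⊑ searchable moves) idx<)
...   | down b p' = begin
    run O (atChild b (if b then m true else m false) >>= λ r → ask [] b r ret)
      ≡⟨ run-bind O (atChild b (if b then m true else m false)) _ ⟩
    selectBV b (run O (atChild b (if b then m true else m false))) β
      ≡⟨ cong (λ r → selectBV b r β) (run-atChild-node selectBV α β t m b) ⟩
    selectBV b (run (selectOracle (t b)) (m b)) β
      ≡⟨ cong (λ r → selectBV b r β) (selectAlg-correct g _ p' idx child-searchable idx<′) ⟩
    selectBV b (selectPrefix (part b rests) p' idx) β
      ≡⟨ selectPrefix-descent idx ⟨
    selectPrefix (s ∷ S) p idx
      ∎
  where
  open Descent searchable uniform moves
  open ≡-Reasoning
  β : List Bool
  β = map headBit rests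
  t : Bool → WT
  t c = wtF g (part c rests)
  O : Oracle
  O = selectOracle (node α β (t false) (t true))
  m : Bool → Prog ℕ
  m c = selectAlg (skel (t c)) p' idx
  idx<′ : idx < countPrefix (part b rests) p'
  idx<′ = subst (idx <_) countPrefix-descent idx<

length<suc-maxLen : ∀ S → All (λ s → length s < suc (maxLen S)) S
length<suc-maxLen []      = []
length<suc-maxLen (s ∷ S) =
  s≤s (m≤m⊔n (length s) (maxLen S)) ∷
  All.map (λ lt → ≤-trans lt (s≤s (m≤n⊔m (length s) (maxLen S)))) (length<suc-maxLen S)

WTof-searchable : ∀ {S p} → PrefixFreeSet S → Any (p ⊑_) S → Searchable (suc (maxLen S)) S p
WTof-searchable {S} prefixFree hit =
  record { hit = hit ; prefixFree = prefixFree ; fuel = length<suc-maxLen S }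

lemma2 :
    (Σ (Skel → BitStr → ℕ → Prog ℕ) λ alg → Σ ℕ λ c →
      (S : List BitStr) → S ≢ [] → PrefixFreeSet S →
      (p : BitStr) → Any (p ⊑_) S →
      (pos : ℕ) → pos ≤ length S →
        (run (rankOracle (WTof S)) (alg (skel (WTof S)) p pos) ≡ rankPrefix S p pos)
        × (cost (rankOracle (WTof S)) (alg (skel (WTof S)) p pos) ≤ c * hp (WTof S) p))
    ×
    (Σ (Skel → BitStr → ℕ → Prog ℕ) λ alg → Σ ℕ λ c →
      (S : List BitStr) → S ≢ [] → PrefixFreeSet S →
      (p : BitStr) → Any (p ⊑_) S →
      (idx : ℕ) → idx < countPrefix S p →
        (run (selectOracle (WTof S)) (alg (skel (WTof S)) p idx) ≡ selectPrefix S p idx)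
        × (cost (selectOracle (WTof S)) (alg (skel (WTof S)) p idx) ≤ c * hp (WTof S) p))
lemma2 =
  ( rankAlg , 1 , λ S _ prefixFree p hit pos pos≤ →
      rankAlg-correct _ S p pos (WTof-searchable prefixFree hit) pos≤ ,
      ≤-trans (rankAlg-cost _ (WTof S) p pos) (≤-reflexive (sym (*-identityˡ _))) )
  ,
  ( selectAlg , 1 , λ S _ prefixFree p hit idx idx< →
      selectAlg-correct _ S p idx (WTof-searchable prefixFree hit) idx< ,
      ≤-trans (selectAlg-cost _ (WTof S) p idx) (≤-reflexive (sym (*-identityˡ _))) )
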